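{- Let $\mathscr D$ be a class of finite graphs with bounded VC-dimension (respectively bounded order-dimension) and let $\mathscr C$ be a class $2$-covered by $\mathscr D$. Then $\mathscr C$ also has bounded VC-dimension (respectively bounded order-dimension).
   Context: The VC-dimension of a graph $G$ is the largest $d$ such that there are vertices $a_1,\dots,a_d$ and vertices $b_J$ for $J\subseteq\{1,\dots,d\}$ with $\{a_i,b_J\}\in E(G)\iff i\in J$. The order-dimension of $G$ is the largest $\ell$ such that there are vertices $a_1,\dots,a_\ell,b_1,\dots,b_\ell$ with $\{a_i,b_j\}\in E(G)\iff i\leq j$. A class has bounded VC-/order-dimension if these are uniformly bounded over the class. A class $\mathscr C$ is $2$-covered by $\mathscr D$ if there is $K\geq 2$ such that every $G\in\mathscr C$ has a vertex partition $V_1,\dots,V_K$ with $G[V_i\cup V_j]\in\mathscr D$ for all $i<j$. -}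

module Defs where

open import Data.Nat using (ℕ; _≤_)
open import Data.Bool using (Bool; true; false; _∨_; if_then_else_)
open import Data.Fin using (Fin) renaming (_≤_ to _≤ᶠ_; _<_ to _<ᶠ_)
open import Data.Fin.Subset using (Subset; _∈_)
open import Data.List using (List; []; _∷_; length; lookup)
open import Data.Vec.Functional using (Vector)
open import Data.Product using (Σ; ∃; _×_)
open import Data.Empty using (⊥)
open import Relation.Nullary.Decidable using (⌊_⌋)
open import Relation.Binary.PropositionalEquality using (_≡_)
open import Function.Bundles using (_⇔_)
import Data.Fin as F
import Data.List as L

record Graph : Set where
  field
    n     : ℕ
    adj   : Fin n → Fin n → Bool
    sym   : ∀ u v → adj u v ≡ adj v u
    irrefl : ∀ v → adj v v ≡ false
open Graph public

Class : Set₁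
Class = Graph → Set

filterᵇ : {A : Set} → (A → Bool) → List A → List A
filterᵇ p [] = []
filterᵇ p (x ∷ xs) = if p x then x ∷ filterᵇ p xs else filterᵇ p xs

members : (G : Graph) → (Fin (n G) → Bool) → List (Fin (n G))
members G S = filterᵇ S (L.allFin (n G))

-- The induced subgraph G[S], with vertex set Fin |S| enumerating S in
-- increasing order.
induced : (G : Graph) → (Fin (n G) → Bool) → Graph
induced G S = record
  { n = length (members G S)
  ; adj = λ i j → adj G (emb i) (emb j)
  ; sym = λ i j → sym G (emb i) (emb j)
  ; irrefl = λ i → irrefl G (emb i)
  }
  where
  emb : Fin (length (members G S)) → Fin (n G)
  emb = lookup (members G S)

Adj : (G : Graph) → Fin (n G) → Fin (n G) → Set
Adj G u v = adj G u v ≡ true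

VCShatters : Graph → ℕ → Set
VCShatters G d =
  Σ (Fin d → Fin (n G)) λ a →
  Σ (Subset d → Fin (n G)) λ b →
  ∀ (i : Fin d) (J : Subset d) → Adj G (a i) (b J) ⇔ (i ∈ J)

OrderShatters : Graph → ℕ → Set
OrderShatters G ℓ =
  Σ (Fin ℓ → Fin (n G)) λ a →
  Σ (Fin ℓ → Fin (n G)) λ b →
  ∀ (i j : Fin ℓ) → Adj G (a i) (b j) ⇔ (i ≤ᶠ j)

BoundedVC : Class → Set
BoundedVC 𝒞 = ∃ λ k → ∀ G → 𝒞 G → ∀ d → VCShatters G d → d ≤ k

BoundedOrder : Class → Set
BoundedOrder 𝒞 = ∃ λ k → ∀ G → 𝒞 G → ∀ ℓ → OrderShatters G ℓ → ℓ ≤ k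

TwoCovered : Class → Class → Set
TwoCovered 𝒞 𝒟 =
  ∃ λ (K : ℕ) → 2 ≤ K ×
    (∀ G → 𝒞 G →
      Σ (Fin (n G) → Fin K) λ p →
        ∀ (i j : Fin K) → i <ᶠ j →
          𝒟 (induced G (λ v → ⌊ p v F.≟ i ⌋ ∨ ⌊ p v F.≟ j ⌋)))

module Submission where

-- Fix a 2-cover with K parts, i.e. a colouring p : V → Fin K of
-- each G ∈ 𝒞 such that G[V_i ∪ V_j] ∈ 𝒟 for i < j.  Both dimensions ask for
-- a bipartite pattern (vertices a_x, b_y with a_x ~ b_y iff R x y).  If the
-- a-side of such a pattern lies in one colour class and the b-side in one
-- colour class, the pattern survives in a graph G[V_i ∪ V_j] of 𝒟.  So it
-- suffices to extract, from a large pattern in G, a still large pattern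
-- with monochromatic sides:
--   * order-dimension: apply the pigeonhole principle (with strictly
--     increasing witnesses) twice, first to the a's, then to the b's;
--   * VC-dimension: pigeonhole the a's into one colour, split K·t of them
--     into K blocks of size t, and show by a "diagonal union" argument that
--     some block r is fully shattered by sets J with b_J of colour r.

open import Defs hiding (sym)
open import Data.Nat using (ℕ; zero; suc; pred; _+_; _*_; _≤_; _<_; z≤n; s≤s; _≤?_)
open import Data.Nat.Properties using (+-suc; ≤-reflexive; ≤-pred; n≤1+n; n<1+n; ≰⇒>; <-irrefl; ≤⇒≯; <⇒≤; m≤n⇒m<n∨m≡n; ≤-refl)
open import Data.Bool using (Bool; true; false; _∨_)
import Data.Bool as Bool
open import Data.Fin using (Fin; zero; suc; toℕ; inject≤; combine; _≟_) renaming (_≤_ to _≤ᶠ_; _<_ to _<ᶠ_)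
import Data.Fin.Properties as FinP
open import Data.Fin.Subset using (Subset; _∈_)
open import Data.Fin.Subset.Properties using (anySubset?)
open import Data.Vec using (lookup; tabulate)
open import Data.Vec.Properties using (lookup∘tabulate; tabulate∘lookup; tabulate-cong; ≡-dec; []=⇒lookup; lookup⇒[]=)
open import Data.Vec.Functional using (Vector; foldr; replicate; updateAt)
open import Data.Vec.Functional.Properties using (updateAt-updates; updateAt-minimal)
open import Data.List using (List; _∷_; length)
import Data.List as List
open import Data.List.Relation.Unary.Any using (Any; here; there)
open import Data.List.Membership.Propositional.Properties using (∈-allFin)
open import Data.Product using (Σ; ∃; _×_; _,_; proj₁; proj₂)
open import Data.Sum using (_⊎_; inj₁; inj₂)
open import Data.Empty using (⊥-elim)
open import Relation.Nullary using (¬_; Dec; yes; no)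
open import Relation.Nullary.Decidable using (⌊_⌋; _×-dec_; ¬?; decidable-stable)
open import Relation.Binary.PropositionalEquality using (_≡_; refl; sym; trans; cong; subst; subst₂)
open import Relation.Binary.Definitions using (tri<; tri≈; tri>)
open import Function using (_∘_)
open import Function.Bundles using (_⇔_; mk⇔; Equivalence)
open import Function.Properties.Equivalence using () renaming (trans to ⇔-trans; sym to ⇔-sym)

StrictlyIncreasing : ∀ {a b} → (Fin a → Fin b) → Set
StrictlyIncreasing h = ∀ {i j} → i <ᶠ j → h i <ᶠ h j

-- A strictly increasing map preserves and reflects the order; this is
-- what lets an order pattern survive passing to a subsequence.
increasing-≤ : ∀ {a b} {h : Fin a → Fin b} → StrictlyIncreasing h →
  ∀ x y → (h x ≤ᶠ h y) ⇔ (x ≤ᶠ y)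
increasing-≤ {h = h} inc x y = mk⇔ reflects preserves
  where
  reflects : h x ≤ᶠ h y → x ≤ᶠ y
  reflects hx≤hy with toℕ x ≤? toℕ y
  ... | yes x≤y = x≤y
  ... | no x≰y = ⊥-elim (≤⇒≯ hx≤hy (inc (≰⇒> x≰y)))
  preserves : x ≤ᶠ y → h x ≤ᶠ h y
  preserves x≤y with m≤n⇒m<n∨m≡n x≤y
  ... | inj₁ x<y = <⇒≤ (inc x<y)
  ... | inj₂ x≡y rewrite FinP.toℕ-injective x≡y = ≤-refl

increasing-injective : ∀ {a b} {h : Fin a → Fin b} → StrictlyIncreasing h →
  ∀ {x y} → h x ≡ h y → x ≡ y
increasing-injective inc {x} {y} e =
  FinP.≤-antisym (Equivalence.to (increasing-≤ inc x y) (≤-reflexive (cong toℕ e)))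
                 (Equivalence.to (increasing-≤ inc y x) (≤-reflexive (cong toℕ (sym e))))

Run : ∀ {ℓ m} → (Fin ℓ → Fin m) → Fin m → ℕ → Set
Run {ℓ} col c N = Σ (Fin N → Fin ℓ) λ h → StrictlyIncreasing h × (∀ i → col (h i) ≡ c)

run-shift : ∀ {ℓ m} (col : Fin (suc ℓ) → Fin m) {c N} → Run (col ∘ suc) c N → Run col c N
run-shift col (h , inc , cols) = suc ∘ h , (λ i<j → s≤s (inc i<j)) , cols

run-cons : ∀ {ℓ m} (col : Fin (suc ℓ) → Fin m) {c N} → col zero ≡ c →
  Run (col ∘ suc) c N → Run col c (suc N)
run-cons {ℓ} col {c} {N} e (h , inc , cols) = h′ , inc′ , cols′
  where
  h′ : Fin (suc N) → Fin (suc ℓ)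
  h′ zero = zero
  h′ (suc i) = suc (h i)
  inc′ : StrictlyIncreasing h′
  inc′ {zero} {suc j} _ = s≤s z≤n
  inc′ {suc i} {suc j} (s≤s i<j) = s≤s (inc i<j)
  cols′ : ∀ i → col (h′ i) ≡ c
  cols′ zero = e
  cols′ (suc i) = cols i

run-truncate : ∀ {ℓ m} (col : Fin ℓ → Fin m) {c M N} → M ≤ N → Run col c N → Run col c M
run-truncate col M≤N (h , inc , cols) =
  (λ i → h (inject≤ i M≤N)) ,
  (λ {i} {j} i<j → inc (subst₂ _<_ (sym (FinP.toℕ-inject≤ i M≤N)) (sym (FinP.toℕ-inject≤ j M≤N)) i<j)) ,
  (λ i → cols (inject≤ i M≤N))

total : ∀ {m} → Vector ℕ m → ℕ
total = foldr _+_ 0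

total-replicate : ∀ m t → total (replicate m t) ≡ m * t
total-replicate zero t = refl
total-replicate (suc m) t = cong (t +_) (total-replicate m t)

total-spend : ∀ {m} (τ : Vector ℕ m) c {x} → τ c ≡ suc x →
  total τ ≡ suc (total (updateAt τ c pred))
total-spend τ zero e rewrite e = refl
total-spend τ (suc c) e = trans (cong (τ zero +_) (total-spend (τ ∘ suc) c e)) (+-suc (τ zero) _)

-- Induction on ℓ: position 0 either
-- exhausts the budget of its colour, or spends one unit of it.
pigeonhole-budget : ∀ ℓ {m} (col : Fin ℓ → Fin m) (τ : Vector ℕ m) → total τ < ℓ →
  Σ (Fin m) λ c → Σ ℕ λ N → τ c < N × Run col c N
pigeonhole-budget (suc ℓ) col τ total<ℓ with τ (col zero) in budget
... | zero = col zero , 1 , s≤s (≤-reflexive budget) , run-cons col refl ((λ ()) , (λ {}) , (λ ()))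
... | suc x with pigeonhole-budget ℓ (col ∘ suc) (updateAt τ (col zero) pred)
                   (≤-pred (subst (_< suc ℓ) (total-spend τ (col zero) budget) total<ℓ))
...   | c , N , spent<N , run with c ≟ col zero
...     | no c≢c0 = c , N , subst (_< N) (updateAt-minimal c (col zero) τ c≢c0) spent<N , run-shift col run
...     | yes refl = c , suc N , s≤s (subst (_≤ N) (sym budget) x<N) , run-cons col refl run
  where
  x<N : x < N
  x<N = subst (_< N) (trans (updateAt-updates c τ) (cong pred budget)) spent<N

pigeonhole : ∀ {ℓ m} (col : Fin ℓ → Fin m) t → m * t < ℓ → Σ (Fin m) λ c → Run col c (suc t)
pigeonhole {ℓ} {m} col t mt<ℓ
  with pigeonhole-budget ℓ col (replicate m t) (subst (_< ℓ) (sym (total-replicate m t)) mt<ℓ)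
... | c , N , t<N , run = c , run-truncate col t<N run

restrict : ∀ {t d} → (Fin t → Fin d) → Subset d → Subset t
restrict f J = tabulate (λ s → lookup J (f s))

∈-restrict : ∀ {t d} (f : Fin t → Fin d) (J : Subset d) s → (s ∈ restrict f J) ⇔ (f s ∈ J)
∈-restrict f J s = mk⇔
  (λ s∈ → lookup⇒[]= (f s) J (trans (sym (lookup∘tabulate _ s)) ([]=⇒lookup s∈)))
  (λ fs∈ → lookup⇒[]= s (restrict f J) (trans (lookup∘tabulate _ s) ([]=⇒lookup fs∈)))

-- Let α r (r < K) be K disjoint blocks of size t in Fin d
-- and colour every subset of Fin d with one of K colours.  Then some block
-- r has every trace J ⊆ Fin t realised by a set of colour r.  Otherwise,
-- choose for each r a trace J_r not realised in colour r; the union J* of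
-- the J_r (placed on their blocks) has some colour r*, and its trace on
-- block r* is J_r*, a contradiction.
module BlockLemma {K t d : ℕ} (α : Fin K → Fin t → Fin d)
  (α-injective : ∀ {r s r′ s′} → α r′ s′ ≡ α r s → r′ ≡ r × s′ ≡ s)
  (colour : Subset d → Fin K) where

  Realised : Fin K → Subset t → Set
  Realised r J = Σ (Subset d) λ J′ → restrict (α r) J′ ≡ J × colour J′ ≡ r

  realised? : ∀ r J → Dec (Realised r J)
  realised? r J = anySubset? (λ J′ → ≡-dec Bool._≟_ (restrict (α r) J′) J ×-dec (colour J′ ≟ r))

  Bad : Fin K → Set
  Bad r = Σ (Subset t) λ J → ¬ Realised r J

  bad? : ∀ r → Dec (Bad r)
  bad? r = anySubset? (λ J → ¬? (realised? r J))

  not-all-bad : ¬ (∀ r → Bad r)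
  not-all-bad allBad = proj₂ (allBad r*) (J* , restrict-J* r* , refl)
    where
    Jr : Fin K → Subset t
    Jr r = proj₁ (allBad r)
    InUnion : Fin d → Set
    InUnion x = ∃ λ r → ∃ λ s → α r s ≡ x × lookup (Jr r) s ≡ true
    inUnion? : ∀ x → Dec (InUnion x)
    inUnion? x = FinP.any? (λ r → FinP.any? (λ s → (α r s ≟ x) ×-dec (lookup (Jr r) s Bool.≟ true)))
    J* : Subset d
    J* = tabulate (λ x → ⌊ inUnion? x ⌋)
    r* : Fin K
    r* = colour J*
    -- By injectivity of α, the union meets block r exactly in J_r.
    on-block : ∀ r s → (dec : Dec (InUnion (α r s))) → ⌊ dec ⌋ ≡ lookup (Jr r) s
    on-block r s (yes (r′ , s′ , e , s′∈)) with α-injective e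
    ... | refl , refl = sym s′∈
    on-block r s (no ∉) with lookup (Jr r) s in s∈?
    ... | true = ⊥-elim (∉ (r , s , refl , s∈?))
    ... | false = refl
    restrict-J* : ∀ r → restrict (α r) J* ≡ Jr r
    restrict-J* r = trans
      (tabulate-cong (λ s → trans (lookup∘tabulate _ (α r s)) (on-block r s (inUnion? (α r s)))))
      (tabulate∘lookup (Jr r))

  block-lemma : Σ (Fin K) λ r → ∀ J → Realised r J
  block-lemma with FinP.all? bad?
  ... | yes allBad = ⊥-elim (not-all-bad allBad)
  ... | no notAllBad with FinP.¬∀⟶∃¬ K Bad bad? notAllBad
  ...   | r , good = r , λ J → decidable-stable (realised? r J) (λ ¬realised → good (J , ¬realised))

-- A bipartite pattern of type R in G: vertices a_x, b_y with a_x ~ b_y iff R x y.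
-- VCShatters G d and OrderShatters G ℓ are the patterns of type _∈_ and _≤_.
Pattern : Graph → {X Y : Set} → (X → Y → Set) → Set
Pattern G {X} {Y} R =
  Σ (X → Fin (n G)) λ a → Σ (Y → Fin (n G)) λ b → ∀ x y → Adj G (a x) (b y) ⇔ R x y

ColouredPattern : (G : Graph) {K : ℕ} → (Fin (n G) → Fin K) →
  {X Y : Set} → (X → Y → Set) → Fin K → Fin K → Set
ColouredPattern G p {X} {Y} R c₁ c₂ =
  Σ (X → Fin (n G)) λ a → Σ (Y → Fin (n G)) λ b →
    (∀ x → p (a x) ≡ c₁) × (∀ y → p (b y) ≡ c₂) × (∀ x y → Adj G (a x) (b y) ⇔ R x y)

filter-complete : {A : Set} (S : A → Bool) (xs : List A) {v : A} →
  Any (v ≡_) xs → S v ≡ true → Σ (Fin (length (filterᵇ S xs))) λ k → List.lookup (filterᵇ S xs) k ≡ v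
filter-complete S (x ∷ xs) (here refl) Sv rewrite Sv = zero , refl
filter-complete S (x ∷ xs) (there v∈xs) Sv with S x | filter-complete S xs v∈xs Sv
... | true | k , e = suc k , e
... | false | k , e = k , e

induced-vertex : (G : Graph) (S : Fin (n G) → Bool) (v : Fin (n G)) → S v ≡ true →
  Σ (Fin (n (induced G S))) λ k → List.lookup (members G S) k ≡ v
induced-vertex G S v Sv = filter-complete S (List.allFin (n G)) (∈-allFin v) Sv

induced-pattern : (G : Graph) (S : Fin (n G) → Bool) {X Y : Set} {R : X → Y → Set}
  (a : X → Fin (n G)) (b : Y → Fin (n G)) → (∀ x → S (a x) ≡ true) → (∀ y → S (b y) ≡ true) →
  (∀ x y → Adj G (a x) (b y) ⇔ R x y) → Pattern (induced G S) R
induced-pattern G S a b Sa Sb realises =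
  proj₁ ∘ a′ , proj₁ ∘ b′ , λ x y → ⇔-trans (same-adjacency (a′ x) (b′ y)) (realises x y)
  where
  Preimage : Fin (n G) → Set
  Preimage v = Σ (Fin (n (induced G S))) λ k → List.lookup (members G S) k ≡ v
  a′ : ∀ x → Preimage (a x)
  a′ x = induced-vertex G S (a x) (Sa x)
  b′ : ∀ y → Preimage (b y)
  b′ y = induced-vertex G S (b y) (Sb y)
  same-adjacency : ∀ {u v} (k : Preimage u) (l : Preimage v) →
    Adj (induced G S) (proj₁ k) (proj₁ l) ⇔ Adj G u v
  same-adjacency (k , refl) (l , refl) = mk⇔ (λ e → e) (λ e → e)

colour-pair : (G : Graph) {K : ℕ} → (Fin (n G) → Fin K) → Fin K → Fin K → Fin (n G) → Bool
colour-pair G p i j v = ⌊ p v ≟ i ⌋ ∨ ⌊ p v ≟ j ⌋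

∈-colour-pair : (G : Graph) {K : ℕ} (p : Fin (n G) → Fin K) {i j c : Fin K} →
  c ≡ i ⊎ c ≡ j → ∀ {v} → p v ≡ c → colour-pair G p i j v ≡ true
∈-colour-pair G p {i} {j} c∈ij {v} refl with p v ≟ i | p v ≟ j | c∈ij
... | yes _ | _ | _ = refl
... | no _ | yes _ | _ = refl
... | no c≢i | no _ | inj₁ c≡i = ⊥-elim (c≢i c≡i)
... | no _ | no c≢j | inj₂ c≡j = ⊥-elim (c≢j c≡j)

colours-in-pair : ∀ {K} → 2 ≤ K → (c₁ c₂ : Fin K) →
  Σ (Fin K) λ i → Σ (Fin K) λ j → i <ᶠ j × (c₁ ≡ i ⊎ c₁ ≡ j) × (c₂ ≡ i ⊎ c₂ ≡ j)
colours-in-pair 2≤K c₁ c₂ with FinP.<-cmp c₁ c₂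
... | tri< c₁<c₂ _ _ = c₁ , c₂ , c₁<c₂ , inj₁ refl , inj₂ refl
... | tri> _ _ c₂<c₁ = c₂ , c₁ , c₂<c₁ , inj₂ refl , inj₁ refl
colours-in-pair (s≤s (s≤s _)) zero _ | tri≈ _ refl _ = zero , suc zero , s≤s z≤n , inj₁ refl , inj₁ refl
colours-in-pair _ (suc c) _ | tri≈ _ refl _ = zero , suc c , s≤s z≤n , inj₂ refl , inj₂ refl

covered-pattern : {𝒟 : Class} {K : ℕ} → 2 ≤ K → (G : Graph) (p : Fin (n G) → Fin K) →
  (∀ i j → i <ᶠ j → 𝒟 (induced G (colour-pair G p i j))) →
  {X Y : Set} {R : X → Y → Set} {c₁ c₂ : Fin K} → ColouredPattern G p R c₁ c₂ →
  Σ Graph λ H → 𝒟 H × Pattern H R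
covered-pattern 2≤K G p inD {c₁ = c₁} {c₂} (a , b , pa , pb , realises)
  with colours-in-pair 2≤K c₁ c₂
... | i , j , i<j , c₁∈ij , c₂∈ij =
  induced G (colour-pair G p i j) , inD i j i<j ,
  induced-pattern G _ a b (λ x → ∈-colour-pair G p c₁∈ij (pa x)) (λ y → ∈-colour-pair G p c₂∈ij (pb y)) realises

-- Order extraction: an order pattern of length ℓ > K·K·t contains one of
-- length t + 1 with both sides monochromatic (pigeonhole on the a's, then
-- on the b's of the surviving indices).
order-extraction : (G : Graph) {K : ℕ} (p : Fin (n G) → Fin K) (t ℓ : ℕ) →
  K * (K * t) < ℓ → OrderShatters G ℓ →
  Σ (Fin K) λ c₁ → Σ (Fin K) λ c₂ → ColouredPattern G p (_≤ᶠ_ {suc t}) c₁ c₂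
order-extraction G {K} p t ℓ big (a , b , realises)
  with pigeonhole (p ∘ a) (K * t) big
... | c₁ , h₁ , inc₁ , col₁ with pigeonhole (p ∘ b ∘ h₁) t (n<1+n (K * t))
...   | c₂ , h₂ , inc₂ , col₂ =
  c₁ , c₂ , a ∘ h , b ∘ h , col₁ ∘ h₂ , col₂ ,
  λ x y → ⇔-trans (realises (h x) (h y)) (increasing-≤ (inc₁ ∘ inc₂) x y)
  where
  h : Fin (suc t) → Fin ℓ
  h = h₁ ∘ h₂

-- VC extraction: a VC pattern of dimension d > K·K·t contains one of
-- dimension t with both sides monochromatic (pigeonhole on the a's, then
-- the block lemma on K blocks of t surviving indices).
vc-extraction : (G : Graph) {K : ℕ} (p : Fin (n G) → Fin K) (t d : ℕ) →
  K * (K * t) < d → VCShatters G d →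
  Σ (Fin K) λ c₁ → Σ (Fin K) λ c₂ → ColouredPattern G p (_∈_ {t}) c₁ c₂
vc-extraction G {K} p t d big (a , b , realises) =
  c₁ , r , a ∘ α r , b ∘ J′ , (λ s → col (combine r s)) , (λ J → proj₂ (proj₂ (realised J))) ,
  λ s J → subst (λ J″ → Adj G (a (α r s)) (b (J′ J)) ⇔ (s ∈ J″)) (proj₁ (proj₂ (realised J)))
                 (⇔-trans (realises (α r s) (J′ J)) (⇔-sym (∈-restrict (α r) (J′ J) s)))
  where
  c₁ : Fin K
  c₁ = proj₁ (pigeonhole (p ∘ a) (K * t) big)
  run : Run (p ∘ a) c₁ (K * t)
  run = run-truncate (p ∘ a) (n≤1+n (K * t)) (proj₂ (pigeonhole (p ∘ a) (K * t) big))
  h : Fin (K * t) → Fin d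
  h = proj₁ run
  col : ∀ i → p (a (h i)) ≡ c₁
  col = proj₂ (proj₂ run)
  -- Block r consists of the positions r·t, …, r·t + t − 1 of the run.
  α : Fin K → Fin t → Fin d
  α r s = h (combine r s)
  α-injective : ∀ {r s r′ s′} → α r′ s′ ≡ α r s → r′ ≡ r × s′ ≡ s
  α-injective e = FinP.combine-injective _ _ _ _ (increasing-injective (proj₁ (proj₂ run)) e)
  open BlockLemma α α-injective (p ∘ b) using (Realised; block-lemma)
  r : Fin K
  r = proj₁ block-lemma
  realised : ∀ J → Realised r J
  realised = proj₂ block-lemma
  J′ : Subset t → Subset d
  J′ J = proj₁ (realised J)

Bounded : (Graph → ℕ → Set) → Class → Set
Bounded Sh 𝒞 = ∃ λ k → ∀ G → 𝒞 G → ∀ ℓ → Sh G ℓ → ℓ ≤ k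

bounded-transfer : {𝒞 𝒟 : Class} (Sh : Graph → ℕ → Set) (B : ℕ → ℕ) →
  (∀ k G → 𝒞 G → ∀ ℓ → B k < ℓ → Sh G ℓ → Σ Graph λ H → 𝒟 H × Sh H (suc k)) →
  Bounded Sh 𝒟 → Bounded Sh 𝒞
bounded-transfer {𝒞} Sh B reduce (k , bound𝒟) = B k , bound𝒞
  where
  bound𝒞 : ∀ G → 𝒞 G → ∀ ℓ → Sh G ℓ → ℓ ≤ B k
  bound𝒞 G G∈𝒞 ℓ sh with ℓ ≤? B k
  ... | yes ℓ≤B = ℓ≤B
  ... | no ℓ≰B with reduce k G G∈𝒞 ℓ (≰⇒> ℓ≰B) sh
  ...   | H , H∈𝒟 , shH = ⊥-elim (<-irrefl refl (bound𝒟 H H∈𝒟 (suc k) shH))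

mainTheorem9 : (𝒟 𝒞 : Class) → TwoCovered 𝒞 𝒟 →
    (BoundedVC 𝒟 → BoundedVC 𝒞) × (BoundedOrder 𝒟 → BoundedOrder 𝒞)
mainTheorem9 𝒟 𝒞 (K , 2≤K , cover) =
  bounded-transfer VCShatters (λ k → K * (K * suc k)) vc-reduction ,
  bounded-transfer OrderShatters (λ k → K * (K * k)) order-reduction
  where
  vc-reduction : ∀ k G → 𝒞 G → ∀ d → K * (K * suc k) < d → VCShatters G d →
    Σ Graph λ H → 𝒟 H × VCShatters H (suc k)
  vc-reduction k G G∈𝒞 d big sh =
    let (p , inD) = cover G G∈𝒞
        (_ , _ , coloured) = vc-extraction G p (suc k) d big sh
    in covered-pattern 2≤K G p inD coloured
  order-reduction : ∀ k G → 𝒞 G → ∀ ℓ → K * (K * k) < ℓ → OrderShatters G ℓ →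
    Σ Graph λ H → 𝒟 H × OrderShatters H (suc k)
  order-reduction k G G∈𝒞 ℓ big sh =
    let (p , inD) = cover G G∈𝒞
        (_ , _ , coloured) = order-extraction G p k ℓ big sh
    in covered-pattern 2≤K G p inD coloured
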